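{- Let $G=(V,E)$ be a directed graph with positive edge weights $w$, $s\in V$, and $T$ an $s$-arborescence. Let $C_i,P_i$ be produced by Stage I and $G_i$, $t_i$ be constructed in Stage II of the Centroid Algorithm (see context), and let $f^*_i$ be a maximum $s$-$t_i$ flow in $G_i$. Then for any $U\in P_i$ with centroid $u$, the amount of flow $f^*_i$ puts on the edge $(u,t_i)$ equals the value of the minimum cut from $\overline{U}$ to $u$ in $G$, i.e., $\min\{w(A,\overline{A}) : A\subset V,\ \overline{U}\subseteq A,\ u\in\overline{A}\}$.
   Context: An $s$-arborescence is a directed spanning tree rooted at $s$ with all edges directed away from $s$. $\overline{X}=V\setminus X$, and $w(A,\overline A)$ denotes the total weight of edges from $A$ to $\overline A$. For a tree on vertex set $U$, a centroid is a vertex whose removal leaves components each of at most $|U|/2$ vertices. Stage I (treating $T$ as undirected): $C_0=\{s\}$, $P_1$ is the set of vertex sets of components of $T$ minus $s$; while $P_i\ne\emptyset$, $C_i$ consists of a chosen centroid of each $U\in P_i$ (called the centroid of $U$) and $P_{i+1}$ is the set of components obtained by removing the chosen centroid from each $U\in P_i$. Stage II: $G_i$ has vertex set $V\cup\{t_i\}$ and edges $E_1\cup E_2\cup E_3$: $E_1=E\cap\bigcup_{U\in P_i}(U\times U)$ with capacities equal to their weights; $E_2$ contains, for each edge $(x,v)\in E\setminus E_1$, an edge $(s,v)$ with capacity equal to the weight of $(x,v)$; $E_3=\{(u,t_i):u\in C_i\}$ with infinite capacity.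
   Formalization: The edge weights w, and with them the flows in $G_i$ including $f^*_i$, take rational values. -}

module Defs where

open import Data.Nat using (ℕ; zero; suc) renaming (_*_ to _*ℕ_; _≤_ to _≤ℕ_)
open import Data.Fin using (Fin; _≟_) renaming (zero to fzero; suc to fsuc)
open import Data.Fin.Subset using (Subset; _∈_; _∉_; _⊆_; ∁; ∣_∣; Nonempty) renaming (_-_ to _∖_)
  renaming (⊤ to Full)
open import Data.Bool using (Bool; true; false; if_then_else_; _∧_; not; T)
open import Data.Maybe using (Maybe; just; nothing)
open import Data.Vec using (lookup)
open import Data.Product using (Σ; ∃; _×_; _,_)
open import Data.Sum using (_⊎_)
open import Relation.Nullary using (¬_; does)
open import Relation.Binary.PropositionalEquality using (_≡_; _≢_)
open import Function using (_∘_; _⇔_)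
open import Data.Rational using (ℚ; 0ℚ; _+_; _-_; _≤_; _<_)

sumFin : {n : ℕ} → (Fin n → ℚ) → ℚ
sumFin {zero}  f = 0ℚ
sumFin {suc n} f = f fzero + sumFin (f ∘ fsuc)

-- Weighted directed graphs on vertex set Fin n.
-- A graph with positive edge weights is a matrix w with w x y ≥ 0;
-- the edge set is E = {(x,y) | 0 < w x y}.

Weights : ℕ → Set
Weights n = Fin n → Fin n → ℚ

NonNeg : {n : ℕ} → Weights n → Set
NonNeg w = ∀ x y → 0ℚ ≤ w x y

Edge : {n : ℕ} → Weights n → Fin n → Fin n → Set
Edge w x y = 0ℚ < w x y

cutW : {n : ℕ} → Weights n → Subset n → ℚ
cutW w A = sumFin λ x → sumFin λ y →
  if lookup A x ∧ not (lookup A y) then w x y else 0ℚ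

-- s-arborescences, represented by a parent function p:
-- the tree edges are (p v , v) for v ≢ s, all directed away from s.

iter : {n : ℕ} → (Fin n → Fin n) → ℕ → Fin n → Fin n
iter p zero    v = v
iter p (suc k) v = p (iter p k v)

IsArborescence : {n : ℕ} → Weights n → Fin n → (Fin n → Fin n) → Set
IsArborescence w s p =
  (∀ v → v ≢ s → Edge w (p v) v) × (∀ v → ∃ λ k → iter p k v ≡ s)

TAdj : {n : ℕ} → Fin n → (Fin n → Fin n) → Fin n → Fin n → Set
TAdj s p x y = (y ≢ s × p y ≡ x) ⊎ (x ≢ s × p x ≡ y)

data PathIn {n : ℕ} (s : Fin n) (p : Fin n → Fin n) (X : Subset n)
     : Fin n → Fin n → Set where
  here : ∀ {x} → x ∈ X → PathIn s p X x x
  step : ∀ {x y z} → PathIn s p X x y → TAdj s p y z → z ∈ X → PathIn s p X x z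

IsComponent : {n : ℕ} → Fin n → (Fin n → Fin n) → Subset n → Subset n → Set
IsComponent s p W X =
  X ⊆ W × Nonempty X
  × (∀ {x y} → x ∈ X → y ∈ X → PathIn s p X x y)
  × (∀ {x y} → x ∈ X → y ∈ W → TAdj s p x y → y ∈ X)

IsCentroid : {n : ℕ} → Fin n → (Fin n → Fin n) → Subset n → Fin n → Set
IsCentroid s p U u =
  u ∈ U × (∀ X → IsComponent s p (U ∖ u) X → 2 *ℕ ∣ X ∣ ≤ℕ ∣ U ∣)

-- Stage I.  ch U is the chosen centroid of U.
-- Part s p ch i U  means  U ∈ P_i  (P_0 is empty; P_1 = components of T - s).

data Part {n : ℕ} (s : Fin n) (p : Fin n → Fin n) (ch : Subset n → Fin n)
     : ℕ → Subset n → Set where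
  base : ∀ {X} → IsComponent s p (Full ∖ s) X → Part s p ch 1 X
  step : ∀ {i U X} → Part s p ch (suc i) U → IsComponent s p (U ∖ ch U) X
       → Part s p ch (suc (suc i)) X

InC : {n : ℕ} → Fin n → (Fin n → Fin n) → (Subset n → Fin n) → ℕ → Fin n → Set
InC s p ch i v = ∃ λ U → Part s p ch i U × ch U ≡ v

SamePart : {n : ℕ} → Fin n → (Fin n → Fin n) → (Subset n → Fin n) → ℕ
         → Fin n → Fin n → Set
SamePart s p ch i x y = ∃ λ U → Part s p ch i U × x ∈ U × y ∈ U

-- The network G_i on nodes Maybe (Fin n); nothing = t_i.
-- 'same' is a boolean decision of SamePart (supplied as a parameter,
-- required to agree with SamePart in the theorem).
-- Finite capacity of (x,y), x y ∈ V:  the E1 edge (x,y) (weight w x y if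
-- (x,y) ∈ E1) plus, when x = s, the total capacity of all E2 copies (s,y),
-- i.e. the sum of w z y over edges (z,y) ∉ E1 (parallel edges merged).

Node : ℕ → Set
Node n = Maybe (Fin n)

capG : {n : ℕ} → Weights n → Fin n → (Fin n → Fin n → Bool) → Fin n → Fin n → ℚ
capG w s same x y =
  (if same x y then w x y else 0ℚ)
  + (if does (x ≟ s)
       then sumFin (λ z → if same z y then 0ℚ else w z y)
       else 0ℚ)

sumNode : {n : ℕ} → (Node n → ℚ) → ℚ
sumNode g = g nothing + sumFin (g ∘ just)

-- feasible s-t_i flow in G_i  (E3 edges (u,t_i), u ∈ C_i, have infinite capacity)
IsFlow : {n : ℕ} → Weights n → Fin n → (Fin n → Fin n) → (Subset n → Fin n) → ℕ
       → (Fin n → Fin n → Bool) → (Node n → Node n → ℚ) → Set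
IsFlow w s p ch i same f =
  (∀ a b → 0ℚ ≤ f a b)
  × (∀ x y → f (just x) (just y) ≤ capG w s same x y)
  × (∀ a → f nothing a ≡ 0ℚ)
  × (∀ u → ¬ InC s p ch i u → f (just u) nothing ≡ 0ℚ)
  × (∀ x → x ≢ s → sumNode (λ a → f a (just x)) ≡ sumNode (λ b → f (just x) b))

flowValue : {n : ℕ} → Fin n → (Node n → Node n → ℚ) → ℚ
flowValue s f = sumNode (λ b → f (just s) b) - sumNode (λ a → f a (just s))

IsMaxFlow : {n : ℕ} → Weights n → Fin n → (Fin n → Fin n) → (Subset n → Fin n) → ℕ
          → (Fin n → Fin n → Bool) → (Node n → Node n → ℚ) → Set
IsMaxFlow w s p ch i same f =
  IsFlow w s p ch i same f
  × (∀ g → IsFlow w s p ch i same g → flowValue s g ≤ flowValue s f)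

IsMinCutValue : {n : ℕ} → Weights n → Subset n → Fin n → ℚ → Set
IsMinCutValue w U u c =
  (∃ λ A → ∁ U ⊆ A × u ∉ A × cutW w A ≡ c)
  × (∀ A → ∁ U ⊆ A → u ∉ A → c ≤ cutW w A)

module Submission where

-- A maximum flow f of G_i admits no augmenting walk, so the set R of vertices reachable from s in
-- its residual network contains no vertex of C_i, in particular not u.  Cut along A = R ∪ Ū: edges
-- from R to Ā are saturated, and every other edge leaving A joins two different parts of P_i and
-- avoids s, so it has capacity 0 in G_i in both directions.  Hence the flow entering t_i from Ā,
-- which is f(u, t_i) because u is the only vertex of U ∩ C_i, equals the G_i-capacity from A to Ā.
-- For y ∈ U the E₂ copies at s of the edges entering y from other parts replace exactly the
-- G-edges from A ∖ U to y, so that capacity is w(A, Ā).  For an arbitrary A ⊇ Ū with u ∉ A the same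
-- comparison and flow conservation give f(u, t_i) ≤ w(A, Ā).

open import Defs
open import Data.Nat using (ℕ; zero; suc; z≤n; s≤s) renaming (_≤_ to _≤ℕ_)
import Data.Nat.Properties as ℕ
open import Data.Fin using (Fin; _≟_) renaming (zero to fzero; suc to fsuc)
open import Data.Fin.Properties using (any?; suc-injective)
open import Data.Fin.Subset using (Subset; _∈_; _∉_; _⊆_; _⊂_; ∁; ∣_∣; ⁅_⁆; _∪_) renaming (_-_ to _∖_)
open import Data.Fin.Subset.Properties
  using (_∈?_; ∣p∣≤n; p⊂q⇒∣p∣<∣q∣; ⊆-antisym; x∈⁅x⁆; x∈⁅y⁆⇒x≡y; p─q⊆p;
         x∉p⇒x∈∁p; x∈∁p⇒x∉p; x∈p∪q⁺; x∈p∪q⁻)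
open import Data.Bool using (Bool; true; false; T; not; _∧_; if_then_else_)
open import Data.Bool.Properties using (T-≡; ¬-not)
open import Data.Maybe using (just; nothing)
open import Data.Vec using (_∷_; lookup; tabulate; here; there)
open import Data.Vec.Properties using (lookup∘tabulate; []=⇒lookup; lookup⇒[]=)
open import Data.Product using (∃; _×_; _,_; proj₁; proj₂)
open import Data.Sum using (_⊎_; inj₁; inj₂)
open import Function using (_∘_; _⇔_; Equivalence)
open import Relation.Nullary using (¬_; Dec; yes; no; does; contradiction)
open import Relation.Nullary.Decidable using (dec-true; dec-false; decidable-stable; _×-dec_; _⊎-dec_; ¬?)
open import Relation.Binary.PropositionalEquality
open import Relation.Binary.Construct.Closure.ReflexiveTransitive
  using (Star; _◅_; _◅◅_) renaming (ε to []; map to mapStar)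
open import Data.Rational using (ℚ; 0ℚ; 1ℚ; ½; +-0-rawMonoid; _+_; _-_; -_; _*_; _≤_; _<_; _⊓_; _<?_)
open import Data.Rational.Properties hiding (_≟_)
open import Data.Rational.Solver using (module +-*-Solver)
open import Algebra.Properties.CommutativeMonoid.Sum +-0-commutativeMonoid
  using (sum; ∑-distrib-+; ∑-comm)
open import Algebra.Properties.Group +-0-group using (x∙y⁻¹≈ε⇒x≈y; x≈y⇒x∙y⁻¹≈ε; ⁻¹-involutive)
open import Algebra.Definitions.RawMonoid +-0-rawMonoid using () renaming (_×_ to _·_)

open +-*-Solver

≤-by-nonneg-difference : ∀ {p q} d → q ≡ p + d → 0ℚ ≤ d → p ≤ q
≤-by-nonneg-difference {p} d q≡p+d 0≤d = begin
  p      ≡⟨ +-identityʳ p ⟨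
  p + 0ℚ ≤⟨ +-monoʳ-≤ p 0≤d ⟩
  p + d  ≡⟨ q≡p+d ⟨
  _      ∎
  where open ≤-Reasoning

0≤q-p : ∀ {p q} → p ≤ q → 0ℚ ≤ q - p
0≤q-p {p} {q} p≤q = begin
  0ℚ    ≡⟨ +-inverseʳ p ⟨
  p - p ≤⟨ +-monoˡ-≤ (- p) p≤q ⟩
  q - p ∎
  where open ≤-Reasoning

+-cancelʳ-≤ : ∀ {p q} r → p + r ≤ q + r → p ≤ q
+-cancelʳ-≤ {p} {q} r p+r≤q+r = begin
  p           ≡⟨ solve 2 (λ p r → p := (p :+ r) :- r) refl p r ⟩
  p + r - r   ≤⟨ +-monoˡ-≤ (- r) p+r≤q+r ⟩
  q + r - r   ≡⟨ solve 2 (λ q r → (q :+ r) :- r := q) refl q r ⟩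
  q           ∎
  where open ≤-Reasoning

+-nonneg : ∀ {p q} → 0ℚ ≤ p → 0ℚ ≤ q → 0ℚ ≤ p + q
+-nonneg 0≤p 0≤q = ≤-trans (≤-reflexive (sym (+-identityʳ 0ℚ))) (+-mono-≤ 0≤p 0≤q)

½*-pos : ∀ {θ} → 0ℚ < θ → 0ℚ < ½ * θ
½*-pos {θ} 0<θ = subst (_< ½ * θ) (*-zeroʳ ½) (*-monoʳ-<-pos ½ 0<θ)

½*θ+½*θ≡θ : ∀ θ → ½ * θ + ½ * θ ≡ θ
½*θ+½*θ≡θ = solve 1 (λ θ → con ½ :* θ :+ con ½ :* θ := θ) refl

small-multiple : ∀ m {θ} → 0ℚ < θ → ∃ λ ε → 0ℚ < ε × ε ≤ θ × m · ε ≤ θ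
small-multiple zero    {θ} 0<θ = θ , 0<θ , ≤-refl , <⇒≤ 0<θ
small-multiple (suc m) {θ} 0<θ with small-multiple m (½*-pos 0<θ)
... | ε , 0<ε , ε≤½θ , mε≤½θ = ε , 0<ε , ≤-trans ε≤½θ ½θ≤θ , ≤-trans (+-mono-≤ ε≤½θ mε≤½θ) (≤-reflexive (½*θ+½*θ≡θ θ))
  where
  ½θ≤θ : ½ * θ ≤ θ
  ½θ≤θ = ≤-by-nonneg-difference (½ * θ) (sym (½*θ+½*θ≡θ θ)) (<⇒≤ (½*-pos 0<θ))

𝟙 : Bool → ℚ → ℚ
𝟙 b q = if b then q else 0ℚ

𝟙-+ : ∀ b p q → 𝟙 b (p + q) ≡ 𝟙 b p + 𝟙 b q
𝟙-+ true  p q = refl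
𝟙-+ false p q = sym (+-identityʳ 0ℚ)

𝟙-- : ∀ b p q → 𝟙 b (p - q) ≡ 𝟙 b p - 𝟙 b q
𝟙-- true  p q = refl
𝟙-- false p q = sym (+-identityʳ 0ℚ)

𝟙-comm : ∀ a b q → 𝟙 a (𝟙 b q) ≡ 𝟙 b (𝟙 a q)
𝟙-comm true  b q = refl
𝟙-comm false true  q = refl
𝟙-comm false false q = refl

𝟙-split : ∀ b q → q ≡ 𝟙 b q + 𝟙 (not b) q
𝟙-split true  q = sym (+-identityʳ q)
𝟙-split false q = sym (+-identityˡ q)

𝟙-∧ : ∀ a b q → 𝟙 (a ∧ b) q ≡ 𝟙 b (𝟙 a q)
𝟙-∧ true  b q = refl
𝟙-∧ false true  q = refl
𝟙-∧ false false q = refl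

𝟙-nonneg : ∀ b {q} → 0ℚ ≤ q → 0ℚ ≤ 𝟙 b q
𝟙-nonneg true  0≤q = 0≤q
𝟙-nonneg false 0≤q = ≤-refl

𝟙≤ : ∀ b {q} → 0ℚ ≤ q → 𝟙 b q ≤ q
𝟙≤ true  0≤q = ≤-refl
𝟙≤ false 0≤q = 0≤q

𝟙-0 : ∀ b → 𝟙 b 0ℚ ≡ 0ℚ
𝟙-0 true  = refl
𝟙-0 false = refl

𝟙-cases : ∀ b q → 𝟙 b q ≡ q ⊎ 𝟙 b q ≡ 0ℚ
𝟙-cases true  q = inj₁ refl
𝟙-cases false q = inj₂ refl

sumFin≡sum : ∀ {n} (f : Fin n → ℚ) → sumFin f ≡ sum f
sumFin≡sum {zero}  f = refl
sumFin≡sum {suc n} f = cong (f fzero +_) (sumFin≡sum (f ∘ fsuc))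

sumFin-cong : ∀ {n} {f g : Fin n → ℚ} → (∀ x → f x ≡ g x) → sumFin f ≡ sumFin g
sumFin-cong {zero}  f≗g = refl
sumFin-cong {suc n} f≗g = cong₂ _+_ (f≗g fzero) (sumFin-cong (f≗g ∘ fsuc))

sumFin-mono : ∀ {n} {f g : Fin n → ℚ} → (∀ x → f x ≤ g x) → sumFin f ≤ sumFin g
sumFin-mono {zero}  f≤g = ≤-refl
sumFin-mono {suc n} f≤g = +-mono-≤ (f≤g fzero) (sumFin-mono (f≤g ∘ fsuc))

sumFin-+ : ∀ {n} (f g : Fin n → ℚ) → sumFin (λ x → f x + g x) ≡ sumFin f + sumFin g
sumFin-+ f g = begin
  sumFin (λ x → f x + g x) ≡⟨ sumFin≡sum (λ x → f x + g x) ⟩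
  sum (λ x → f x + g x)    ≡⟨ ∑-distrib-+ f g ⟩
  sum f + sum g            ≡⟨ cong₂ _+_ (sumFin≡sum f) (sumFin≡sum g) ⟨
  sumFin f + sumFin g      ∎
  where open ≡-Reasoning

sumFin-swap : ∀ {m n} (f : Fin m → Fin n → ℚ) →
              sumFin (λ x → sumFin (f x)) ≡ sumFin (λ y → sumFin (λ x → f x y))
sumFin-swap f = begin
  sumFin (λ x → sumFin (f x))             ≡⟨ sumFin-cong (sumFin≡sum ∘ f) ⟩
  sumFin (λ x → sum (f x))                ≡⟨ sumFin≡sum (λ x → sum (f x)) ⟩
  sum (λ x → sum (f x))                   ≡⟨ ∑-comm f ⟩
  sum (λ y → sum (λ x → f x y))           ≡⟨ sumFin≡sum (λ y → sum (λ x → f x y)) ⟨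
  sumFin (λ y → sum (λ x → f x y))        ≡⟨ sumFin-cong (λ y → sumFin≡sum (λ x → f x y)) ⟨
  sumFin (λ y → sumFin (λ x → f x y))     ∎
  where open ≡-Reasoning

sumFin-neg : ∀ {n} (f : Fin n → ℚ) → sumFin (λ x → - f x) ≡ - sumFin f
sumFin-neg {zero}  f = refl
sumFin-neg {suc n} f = trans (cong (- f fzero +_) (sumFin-neg (f ∘ fsuc)))
  (solve 2 (λ a b → (:- a) :+ (:- b) := :- (a :+ b)) refl (f fzero) (sumFin (f ∘ fsuc)))

sumFin-- : ∀ {n} (f g : Fin n → ℚ) → sumFin (λ x → f x - g x) ≡ sumFin f - sumFin g
sumFin-- f g = trans (sumFin-+ f (λ x → - g x)) (cong (sumFin f +_) (sumFin-neg g))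

sumFin-zero : ∀ {n} {f : Fin n → ℚ} → (∀ x → f x ≡ 0ℚ) → sumFin f ≡ 0ℚ
sumFin-zero {zero}  f≗0 = refl
sumFin-zero {suc n} f≗0 = trans (cong₂ _+_ (f≗0 fzero) (sumFin-zero (f≗0 ∘ fsuc))) (+-identityʳ 0ℚ)

sumFin-single : ∀ {n} {f : Fin n → ℚ} a → (∀ x → x ≢ a → f x ≡ 0ℚ) → sumFin f ≡ f a
sumFin-single {suc n} {f} fzero others≡0 =
  trans (cong (f fzero +_) (sumFin-zero (λ x → others≡0 (fsuc x) λ ()))) (+-identityʳ _)
sumFin-single {suc n} {f} (fsuc a) others≡0 =
  trans (cong₂ _+_ (others≡0 fzero λ ()) (sumFin-single a λ x x≢a → others≡0 (fsuc x) (x≢a ∘ suc-injective)))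
        (+-identityˡ _)

sumFin-nonneg : ∀ {n} {f : Fin n → ℚ} → (∀ x → 0ℚ ≤ f x) → 0ℚ ≤ sumFin f
sumFin-nonneg {zero}  0≤f = ≤-refl
sumFin-nonneg {suc n} 0≤f = ≤-trans (≤-reflexive (sym (+-identityʳ 0ℚ))) (+-mono-≤ (0≤f fzero) (sumFin-nonneg (0≤f ∘ fsuc)))

term≤sumFin : ∀ {n} {f : Fin n → ℚ} → (∀ x → 0ℚ ≤ f x) → ∀ a → f a ≤ sumFin f
term≤sumFin {suc n} {f} 0≤f fzero =
  ≤-by-nonneg-difference (sumFin (f ∘ fsuc)) refl (sumFin-nonneg (0≤f ∘ fsuc))
term≤sumFin {suc n} {f} 0≤f (fsuc a) = ≤-trans (term≤sumFin (0≤f ∘ fsuc) a)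
  (≤-by-nonneg-difference (f fzero) (+-comm (f fzero) _) (0≤f fzero))

𝟙-sumFin : ∀ {n} b (f : Fin n → ℚ) → 𝟙 b (sumFin f) ≡ sumFin (λ x → 𝟙 b (f x))
𝟙-sumFin true  f = refl
𝟙-sumFin false f = sym (sumFin-zero {f = λ x → 𝟙 false (f x)} λ _ → refl)

sumFin-split : ∀ {n} (b : Fin n → Bool) (f : Fin n → ℚ) →
               sumFin f ≡ sumFin (λ x → 𝟙 (b x) (f x)) + sumFin (λ x → 𝟙 (not (b x)) (f x))
sumFin-split b f = trans (sumFin-cong λ x → 𝟙-split (b x) (f x))
  (sumFin-+ (λ x → 𝟙 (b x) (f x)) (λ x → 𝟙 (not (b x)) (f x)))

_==_ : ∀ {n} → Fin n → Fin n → Bool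
x == y = does (x ≟ y)

==-refl : ∀ {n} (x : Fin n) → (x == x) ≡ true
==-refl x = dec-true (x ≟ x) refl

==-≢ : ∀ {n} {x y : Fin n} → x ≢ y → (x == y) ≡ false
==-≢ {x = x} {y} = dec-false (x ≟ y)

sumFin-δ : ∀ {n} (a : Fin n) (g : Fin n → ℚ) → sumFin (λ x → 𝟙 (x == a) (g x)) ≡ g a
sumFin-δ a g = trans (sumFin-single a λ x x≢a → cong (λ b → 𝟙 b (g x)) (==-≢ x≢a))
                     (cong (λ b → 𝟙 b (g a)) (==-refl a))

module _ {n : ℕ} {A : Subset n} {x : Fin n} where

  𝟙-∈ : x ∈ A → ∀ q → 𝟙 (lookup A x) q ≡ q
  𝟙-∈ x∈A q rewrite []=⇒lookup x∈A = refl

  𝟙-∉ : x ∉ A → ∀ q → 𝟙 (not (lookup A x)) q ≡ q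
  𝟙-∉ x∉A q with lookup A x in eq
  ... | true  = contradiction (lookup⇒[]= x A eq) x∉A
  ... | false = refl

  𝟙-∉-cong : ∀ {p q} → (x ∉ A → p ≡ q) → 𝟙 (not (lookup A x)) p ≡ 𝟙 (not (lookup A x)) q
  𝟙-∉-cong p≡q with lookup A x in eq
  ... | true  = refl
  ... | false = cong (𝟙 true) (p≡q λ x∈A → contradiction (trans (sym ([]=⇒lookup x∈A)) eq) λ ())

  𝟙-∈-mono : ∀ {p q} → (x ∈ A → p ≤ q) → 𝟙 (lookup A x) p ≤ 𝟙 (lookup A x) q
  𝟙-∈-mono p≤q with lookup A x in eq
  ... | true  = p≤q (lookup⇒[]= x A eq)
  ... | false = ≤-refl

  𝟙-∉-mono : ∀ {p q} → (x ∉ A → p ≤ q) → 𝟙 (not (lookup A x)) p ≤ 𝟙 (not (lookup A x)) q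
  𝟙-∉-mono p≤q with lookup A x in eq
  ... | true  = ≤-refl
  ... | false = p≤q λ x∈A → contradiction (trans (sym ([]=⇒lookup x∈A)) eq) λ ()

∈-tabulate⁺ : ∀ {n} {P : Fin n → Set} (P? : ∀ x → Dec (P x)) {x} → P x → x ∈ tabulate (does ∘ P?)
∈-tabulate⁺ P? {x} px = lookup⇒[]= x _ (trans (lookup∘tabulate (does ∘ P?) x) (dec-true (P? x) px))

∈-tabulate⁻ : ∀ {n} {P : Fin n → Set} (P? : ∀ x → Dec (P x)) {x} → x ∈ tabulate (does ∘ P?) → P x
∈-tabulate⁻ P? {x} x∈ with P? x | trans (sym (lookup∘tabulate (does ∘ P?) x)) ([]=⇒lookup x∈)
... | yes px | _  = px
... | no _   | ()

y∉p∖y : ∀ {n} (p : Subset n) y → y ∉ p ∖ y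
y∉p∖y (_ ∷ p) fzero    ()
y∉p∖y (_ ∷ p) (fsuc y) (there y∈) = y∉p∖y p y y∈

x∈p∖y⇒x≢y : ∀ {n} {p : Subset n} {x y} → x ∈ p ∖ y → x ≢ y
x∈p∖y⇒x≢y {p = p} x∈ refl = y∉p∖y p _ x∈

⊆⇒⊇⊎⊂ : ∀ {n} {p q : Subset n} → p ⊆ q → q ⊆ p ⊎ p ⊂ q
⊆⇒⊇⊎⊂ {p = p} {q} p⊆q with any? (λ x → x ∈? q ×-dec ¬? (x ∈? p))
... | yes (x , x∈q , x∉p) = inj₂ (p⊆q , x , x∈q , x∉p)
... | no ∄                = inj₁ λ {x} x∈q → decidable-stable (x ∈? p) λ x∉p → ∄ (x , x∈q , x∉p)

-- Stage I: components and parts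

module Components {n : ℕ} (s : Fin n) (p : Fin n → Fin n) where

  path-stays-in-component : ∀ {W X X′ x z} → IsComponent s p W X → IsComponent s p W X′ →
                            x ∈ X′ → PathIn s p X x z → z ∈ X′
  path-stays-in-component _ _ x∈X′ (here _) = x∈X′
  path-stays-in-component cX cX′@(_ , _ , _ , closed′) x∈X′ (step path adj z∈X) =
    closed′ (path-stays-in-component cX cX′ x∈X′ path) (proj₁ cX z∈X) adj

  component-unique : ∀ {W X X′ x} → IsComponent s p W X → IsComponent s p W X′ →
                     x ∈ X → x ∈ X′ → X ≡ X′
  component-unique cX cX′ x∈X x∈X′ = ⊆-antisym
    (λ y∈X → path-stays-in-component cX cX′ x∈X′ (proj₁ (proj₂ (proj₂ cX)) x∈X y∈X))
    (λ y∈X′ → path-stays-in-component cX′ cX x∈X (proj₁ (proj₂ (proj₂ cX′)) x∈X′ y∈X′))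

  module _ (ch : Subset n → Fin n) where

    part-excludes-root : ∀ {i U x} → Part s p ch i U → x ∈ U → x ≢ s
    part-excludes-root (base cX)   x∈X = x∈p∖y⇒x≢y (proj₁ cX x∈X)
    part-excludes-root (step pU cX) x∈X = part-excludes-root pU (p─q⊆p _ _ (proj₁ cX x∈X))

    part-unique : ∀ {i U U′ x} → Part s p ch i U → Part s p ch i U′ → x ∈ U → x ∈ U′ → U ≡ U′
    part-unique (base cX) (base cX′) x∈ x∈′ = component-unique cX cX′ x∈ x∈′
    part-unique (step pY cX) (step pY′ cX′) x∈ x∈′
      with refl ← part-unique pY pY′ (p─q⊆p _ _ (proj₁ cX x∈)) (p─q⊆p _ _ (proj₁ cX′ x∈′))
      = component-unique cX cX′ x∈ x∈′

-- Reachability in a finite digraph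

module Reachability {n : ℕ} {E : Fin n → Fin n → Set} (E? : ∀ x y → Dec (E x y)) (s : Fin n) where

  grow : Subset n → Subset n
  grow R = tabulate (does ∘ λ y → any? λ x → x ∈? R ×-dec (x ≟ y ⊎-dec E? x y))

  ∈grow⁺ : ∀ {R x y} → x ∈ R → x ≡ y ⊎ E x y → y ∈ grow R
  ∈grow⁺ {R} {x} {y} x∈R x→y = ∈-tabulate⁺ (λ y → any? λ x → x ∈? R ×-dec (x ≟ y ⊎-dec E? x y)) (x , x∈R , x→y)

  ∈grow⁻ : ∀ {R y} → y ∈ grow R → ∃ λ x → x ∈ R × (x ≡ y ⊎ E x y)
  ∈grow⁻ {R} = ∈-tabulate⁻ (λ y → any? λ x → x ∈? R ×-dec (x ≟ y ⊎-dec E? x y))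

  ⊆grow : ∀ {R} → R ⊆ grow R
  ⊆grow x∈R = ∈grow⁺ x∈R (inj₁ refl)

  within : ℕ → Subset n
  within zero    = ⁅ s ⁆
  within (suc k) = grow (within k)

  source-within : ∀ k → s ∈ within k
  source-within zero    = x∈⁅x⁆ s
  source-within (suc k) = ⊆grow (source-within k)

  path-within : ∀ k {y} → y ∈ within k → Star E s y
  path-within zero    y∈ with refl ← x∈⁅y⁆⇒x≡y s y∈ = []
  path-within (suc k) y∈ with ∈grow⁻ y∈
  ... | x , x∈ , inj₁ refl = path-within k x∈
  ... | x , x∈ , inj₂ e    = path-within k x∈ ◅◅ (e ◅ [])

  stable-or-large : ∀ k → grow (within k) ⊆ within k ⊎ k ≤ℕ ∣ within k ∣
  stable-or-large zero = inj₂ z≤n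
  stable-or-large (suc k) with ⊆⇒⊇⊎⊂ (⊆grow {within k})
  ... | inj₁ shrink = inj₁ (subst (λ R → grow R ⊆ R) (⊆-antisym ⊆grow shrink) shrink)
  ... | inj₂ strict@(_ , x , x∈new , x∉old) with stable-or-large k
  ...   | inj₁ stable = contradiction (stable x∈new) x∉old
  ...   | inj₂ k≤∣R∣  = inj₂ (ℕ.≤-trans (s≤s k≤∣R∣) (p⊂q⇒∣p∣<∣q∣ strict))

  -- n + 1 rounds suffice: a round either adds a vertex or changes nothing from then on
  reachable : Subset n
  reachable = within (suc n)

  reachable-closed : grow reachable ⊆ reachable
  reachable-closed with stable-or-large (suc n)
  ... | inj₁ stable = stable
  ... | inj₂ large  = contradiction (ℕ.≤-trans large (∣p∣≤n reachable)) ℕ.1+n≰n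

  source-reachable : s ∈ reachable
  source-reachable = source-within (suc n)

  reachable-step : ∀ {x y} → x ∈ reachable → E x y → y ∈ reachable
  reachable-step x∈ e = reachable-closed (∈grow⁺ x∈ (inj₂ e))

  reachable-path : ∀ {y} → y ∈ reachable → Star E s y
  reachable-path = path-within (suc n)

-- Weight crossing a cut

inflowFrom : ∀ {n} → Subset n → (Fin n → Fin n → ℚ) → Fin n → ℚ
inflowFrom A u y = sumFin λ x → 𝟙 (lookup A x) (u x y)

crossing : ∀ {n} → Subset n → (Fin n → Fin n → ℚ) → ℚ
crossing A u = sumFin λ y → 𝟙 (not (lookup A y)) (inflowFrom A u y)

cutW≡crossing : ∀ {n} (w : Weights n) A → cutW w A ≡ crossing A w
cutW≡crossing w A = trans (sumFin-swap (λ x y → 𝟙 (lookup A x ∧ not (lookup A y)) (w x y)))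
  (sumFin-cong λ y → trans (sumFin-cong λ x → 𝟙-∧ (lookup A x) (not (lookup A y)) (w x y))
                           (sym (𝟙-sumFin (not (lookup A y)) λ x → 𝟙 (lookup A x) (w x y))))

inflowFrom-mono : ∀ {n} {A : Subset n} {u v y} → (∀ {x} → x ∈ A → u x y ≤ v x y) →
                  inflowFrom A u y ≤ inflowFrom A v y
inflowFrom-mono u≤v = sumFin-mono λ x → 𝟙-∈-mono {x = x} u≤v

crossing-mono : ∀ {n} {A : Subset n} {u v} → (∀ {y} → y ∉ A → inflowFrom A u y ≤ inflowFrom A v y) →
                crossing A u ≤ crossing A v
crossing-mono u≤v = sumFin-mono λ y → 𝟙-∉-mono {x = y} u≤v

sumFin-antisymmetric≡0 : ∀ {n} (b : Fin n → Bool) (F : Fin n → Fin n → ℚ) →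
  sumFin (λ y → 𝟙 (b y) (sumFin λ x → 𝟙 (b x) (F x y - F y x))) ≡ 0ℚ
sumFin-antisymmetric≡0 {n} b F = begin
  sumFin (λ y → 𝟙 (b y) (sumFin λ x → 𝟙 (b x) (F x y - F y x)))
    ≡⟨ sumFin-cong (λ y → trans (𝟙-sumFin (b y) λ x → 𝟙 (b x) (F x y - F y x)) (sumFin-cong λ x → inner x y)) ⟩
  sumFin (λ y → sumFin λ x → H x y - H y x)
    ≡⟨ trans (sumFin-cong λ y → sumFin-- (λ x → H x y) (λ x → H y x)) (sumFin-- (λ y → sumFin λ x → H x y) (λ y → sumFin λ x → H y x)) ⟩
  sumFin (λ y → sumFin λ x → H x y) - sumFin (λ y → sumFin λ x → H y x)
    ≡⟨ cong (λ q → sumFin (λ y → sumFin λ x → H x y) - q) (sumFin-swap H) ⟩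
  sumFin (λ y → sumFin λ x → H x y) - sumFin (λ y → sumFin λ x → H x y)
    ≡⟨ +-inverseʳ (sumFin λ y → sumFin λ x → H x y) ⟩
  0ℚ ∎
  where
  open ≡-Reasoning
  H : Fin n → Fin n → ℚ
  H x y = 𝟙 (b y) (𝟙 (b x) (F x y))
  inner : ∀ x y → 𝟙 (b y) (𝟙 (b x) (F x y - F y x)) ≡ H x y - H y x
  inner x y = trans (cong (𝟙 (b y)) (𝟙-- (b x) _ _))
                    (trans (𝟙-- (b y) _ _) (cong (λ q → H x y - q) (𝟙-comm (b y) (b x) (F y x))))

-- Flows in a network whose sink is fed by infinite-capacity edges from C

module Network {n : ℕ} (cap : Fin n → Fin n → ℚ) (s : Fin n) (C : Fin n → Set) where

  Flow : Set
  Flow = Node n → Node n → ℚ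

  inflow outflow netOutflow : Flow → Fin n → ℚ
  inflow  f x = sumNode λ a → f a (just x)
  outflow f x = sumNode λ b → f (just x) b
  netOutflow f x = outflow f x - inflow f x

  netFlow residual : Flow → Fin n → Fin n → ℚ
  netFlow  f x y = f (just x) (just y) - f (just y) (just x)
  residual f x y = cap x y - f (just x) (just y) + f (just y) (just x)

  -- for cap = capG w s same and C = InC s p ch i these are IsFlow and IsMaxFlow of Defs
  IsNetworkFlow : Flow → Set
  IsNetworkFlow f =
    (∀ a b → 0ℚ ≤ f a b)
    × (∀ x y → f (just x) (just y) ≤ cap x y)
    × (∀ a → f nothing a ≡ 0ℚ)
    × (∀ u → ¬ C u → f (just u) nothing ≡ 0ℚ)
    × (∀ x → x ≢ s → inflow f x ≡ outflow f x)

  IsMaxNetworkFlow : Flow → Set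
  IsMaxNetworkFlow f = IsNetworkFlow f × (∀ g → IsNetworkFlow g → flowValue s g ≤ flowValue s f)

  record Feasible (f : Flow) : Set where
    field
      nonneg             : ∀ a b → 0ℚ ≤ f a b
      within-capacity    : ∀ x y → f (just x) (just y) ≤ cap x y
      sink-emits-nothing : ∀ a → f nothing a ≡ 0ℚ
      sink-fed-from-C    : ∀ u → ¬ C u → f (just u) nothing ≡ 0ℚ

  flow-feasible : ∀ {f} → IsNetworkFlow f → Feasible f
  flow-feasible (nonneg , within-capacity , sink-emits-nothing , sink-fed-from-C , _) =
    record { nonneg = nonneg ; within-capacity = within-capacity
           ; sink-emits-nothing = sink-emits-nothing ; sink-fed-from-C = sink-fed-from-C }

  flow-balanced : ∀ {f} → IsNetworkFlow f → ∀ x → x ≢ s → netOutflow f x ≡ 0ℚ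
  flow-balanced (_ , _ , _ , _ , conserved) x x≢s = x≈y⇒x∙y⁻¹≈ε (sym (conserved x x≢s))

  balanced-flow : ∀ {f} → Feasible f → (∀ x → x ≢ s → netOutflow f x ≡ 0ℚ) → IsNetworkFlow f
  balanced-flow feasible balanced =
    nonneg , within-capacity , sink-emits-nothing , sink-fed-from-C ,
    λ x x≢s → sym (x∙y⁻¹≈ε⇒x≈y _ _ (balanced x x≢s))
    where open Feasible feasible

  netFlow≤cap : ∀ {f} → Feasible f → ∀ x y → netFlow f x y ≤ cap x y
  netFlow≤cap {f} feasible x y = ≤-trans
    (≤-by-nonneg-difference (f (just y) (just x))
      (solve 2 (λ a b → a := (a :- b) :+ b) refl (f (just x) (just y)) (f (just y) (just x)))
      (nonneg _ _))
    (within-capacity x y)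
    where open Feasible feasible

  saturated : ∀ {f x y} → residual f x y ≤ 0ℚ → cap x y ≤ netFlow f x y
  saturated {f} {x} {y} res≤0 = ≤-by-nonneg-difference (- residual f x y)
    (solve 3 (λ c a b → a :- b := c :+ (:- ((c :- a) :+ b))) refl (cap x y) (f (just x) (just y)) (f (just y) (just x)))
    (neg-antimono-≤ res≤0)

  no-backflow : ∀ {f} → Feasible f → ∀ {x y} → cap y x ≡ 0ℚ → 0ℚ ≤ netFlow f x y
  no-backflow {f} feasible {x} {y} cap≡0 = +-nonneg (nonneg _ _)
    (neg-antimono-≤ (≤-trans (within-capacity y x) (≤-reflexive cap≡0)))
    where open Feasible feasible

  bump : Flow → Fin n → Fin n → ℚ → Flow
  bump f a b q (just x) (just y) = f (just x) (just y) + 𝟙 (x == a) (𝟙 (y == b) q)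
  bump f a b q (just x) nothing  = f (just x) nothing
  bump f a b q nothing  y        = f nothing y

  private
    regroup : ∀ c (g d : Fin n → ℚ) → c + sumFin (λ y → g y + d y) ≡ (c + sumFin g) + sumFin d
    regroup c g d = trans (cong (c +_) (sumFin-+ g d)) (sym (+-assoc c (sumFin g) (sumFin d)))

  outflow-bump : ∀ f a b q x → outflow (bump f a b q) x ≡ outflow f x + 𝟙 (x == a) q
  outflow-bump f a b q x = trans (regroup (f (just x) nothing) (λ y → f (just x) (just y)) (λ y → 𝟙 (x == a) (𝟙 (y == b) q)))
    (cong (outflow f x +_) (trans (sym (𝟙-sumFin (x == a) λ y → 𝟙 (y == b) q)) (cong (𝟙 (x == a)) (sumFin-δ b λ _ → q))))

  inflow-bump : ∀ f a b q x → inflow (bump f a b q) x ≡ inflow f x + 𝟙 (x == b) q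
  inflow-bump f a b q x = trans (regroup (f nothing (just x)) (λ y → f (just y) (just x)) (λ y → 𝟙 (y == a) (𝟙 (x == b) q)))
    (cong (inflow f x +_) (sumFin-δ a λ _ → 𝟙 (x == b) q))

  netOutflow-bump : ∀ f a b q x → netOutflow (bump f a b q) x ≡ netOutflow f x + (𝟙 (x == a) q - 𝟙 (x == b) q)
  netOutflow-bump f a b q x = trans (cong₂ _-_ (outflow-bump f a b q x) (inflow-bump f a b q x))
    (solve 4 (λ o i qa qb → (o :+ qa) :- (i :+ qb) := (o :- i) :+ (qa :- qb)) refl
      (outflow f x) (inflow f x) (𝟙 (x == a) q) (𝟙 (x == b) q))

  bump-entry : ∀ (P : Fin n → Fin n → ℚ → Set) f a b q x y →
    P x y (f (just x) (just y)) → P a b (f (just a) (just b) + q) → P x y (bump f a b q (just x) (just y))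
  bump-entry P f a b q x y unchanged changed with x ≟ a | y ≟ b
  ... | yes refl | yes refl = changed
  ... | yes refl | no _     = subst (P x y) (sym (+-identityʳ _)) unchanged
  ... | no _     | _        = subst (P x y) (sym (+-identityʳ _)) unchanged

  bump-feasible : ∀ {f} a b q → Feasible f →
    0ℚ ≤ f (just a) (just b) + q → f (just a) (just b) + q ≤ cap a b → Feasible (bump f a b q)
  bump-feasible {f} a b q feasible 0≤fab+q fab+q≤cap = record
    { nonneg             = nonneg′
    ; within-capacity    = λ x y → bump-entry (λ x y v → v ≤ cap x y) f a b q x y (within-capacity x y) fab+q≤cap
    ; sink-emits-nothing = sink-emits-nothing
    ; sink-fed-from-C    = sink-fed-from-C
    }
    where
    open Feasible feasible
    nonneg′ : ∀ c d → 0ℚ ≤ bump f a b q c d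
    nonneg′ (just x) (just y) = bump-entry (λ _ _ v → 0ℚ ≤ v) f a b q x y (nonneg _ _) 0≤fab+q
    nonneg′ (just x) nothing  = nonneg _ _
    nonneg′ nothing  d        = nonneg _ _

  bump-lowers : ∀ f a b {q} → q ≤ 0ℚ → ∀ x y → bump f a b q (just x) (just y) ≤ f (just x) (just y)
  bump-lowers f a b {q} q≤0 x y = bump-entry (λ x y v → v ≤ f (just x) (just y)) f a b q x y ≤-refl
    (≤-trans (+-monoʳ-≤ (f (just a) (just b)) q≤0) (≤-reflexive (+-identityʳ _)))

  bump-residual : ∀ f a b {q d} → 0ℚ ≤ d → q ≤ d → - q ≤ d → ∀ x y →
                  residual f x y ≤ residual (bump f a b q) x y + d
  bump-residual f a b {q} {d} 0≤d q≤d -q≤d x y = begin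
    residual f x y                 ≡⟨ solve 5 (λ c u v P Q → (c :- u) :+ v := ((c :- (u :+ P)) :+ (v :+ Q)) :+ (P :- Q)) refl
                                        (cap x y) (f (just x) (just y)) (f (just y) (just x)) P Q ⟩
    residual (bump f a b q) x y + (P - Q) ≤⟨ +-monoʳ-≤ (residual (bump f a b q) x y) (bound (𝟙𝟙-cases (x == a) (y == b)) (𝟙𝟙-cases (y == a) (x == b))) ⟩
    residual (bump f a b q) x y + d ∎
    where
    open ≤-Reasoning
    P = 𝟙 (x == a) (𝟙 (y == b) q)
    Q = 𝟙 (y == a) (𝟙 (x == b) q)
    𝟙𝟙-cases : ∀ c e → 𝟙 c (𝟙 e q) ≡ q ⊎ 𝟙 c (𝟙 e q) ≡ 0ℚ
    𝟙𝟙-cases true  e = 𝟙-cases e q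
    𝟙𝟙-cases false e = inj₂ refl
    bound : ∀ {p r} → p ≡ q ⊎ p ≡ 0ℚ → r ≡ q ⊎ r ≡ 0ℚ → p - r ≤ d
    bound (inj₁ refl) (inj₁ refl) = ≤-trans (≤-reflexive (+-inverseʳ q)) 0≤d
    bound (inj₁ refl) (inj₂ refl) = ≤-trans (≤-reflexive (+-identityʳ q)) q≤d
    bound (inj₂ refl) (inj₁ refl) = ≤-trans (≤-reflexive (+-identityˡ (- q))) -q≤d
    bound (inj₂ refl) (inj₂ refl) = 0≤d

  -- pushing ε along a residual edge (a, b): first cancel what can be cancelled of the flow on (b, a)
  cancellable : Flow → Fin n → Fin n → ℚ → ℚ
  cancellable f a b ε = ε ⊓ f (just b) (just a)

  push : Flow → Fin n → Fin n → ℚ → Flow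
  push f a b ε = bump (bump f b a (- β)) a b (ε - β)
    where β = cancellable f a b ε

  netOutflow-push : ∀ f a b ε x → netOutflow (push f a b ε) x ≡ netOutflow f x + (𝟙 (x == a) ε - 𝟙 (x == b) ε)
  netOutflow-push f a b ε x = begin
    netOutflow (push f a b ε) x
      ≡⟨ netOutflow-bump (bump f b a (- β)) a b (ε - β) x ⟩
    netOutflow (bump f b a (- β)) x + (𝟙 (x == a) (ε - β) - 𝟙 (x == b) (ε - β))
      ≡⟨ cong₂ (λ N D → N + D) (netOutflow-bump f b a (- β) x)
                               (cong₂ _-_ (𝟙-+ (x == a) ε (- β)) (𝟙-+ (x == b) ε (- β))) ⟩
    netOutflow f x + (𝟙 (x == b) (- β) - 𝟙 (x == a) (- β)) + ((εa + βa) - (εb + βb))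
      ≡⟨ solve 5 (λ N A B A′ B′ → (N :+ (B′ :- A′)) :+ ((A :+ A′) :- (B :+ B′)) := N :+ (A :- B)) refl
           (netOutflow f x) εa εb βa βb ⟩
    netOutflow f x + (εa - εb) ∎
    where
    open ≡-Reasoning
    β = cancellable f a b ε
    εa = 𝟙 (x == a) ε
    εb = 𝟙 (x == b) ε
    βa = 𝟙 (x == a) (- β)
    βb = 𝟙 (x == b) (- β)

  push-feasible : ∀ {f a b ε} → Feasible f → 0ℚ ≤ ε → ε ≤ residual f a b → Feasible (push f a b ε)
  push-feasible {f} {a} {b} {ε} feasible 0≤ε ε≤res =
    bump-feasible a b (ε - β) cancelled
      (+-nonneg (Feasible.nonneg cancelled (just a) (just b)) (0≤q-p β≤ε))
      (≤-trans (+-monoˡ-≤ (ε - β) (bump-lowers f b a (neg-antimono-≤ 0≤β) a b)) fab+ε-β≤cap)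
    where
    open Feasible feasible
    fab = f (just a) (just b)
    fba = f (just b) (just a)
    β = cancellable f a b ε
    β≤ε : β ≤ ε
    β≤ε = p⊓q≤p ε fba
    0≤β : 0ℚ ≤ β
    0≤β = ⊓-glb 0≤ε (nonneg _ _)
    fba-β≤cap : fba - β ≤ cap b a
    fba-β≤cap = ≤-trans (≤-by-nonneg-difference β (solve 2 (λ u v → u := (u :- v) :+ v) refl fba β) 0≤β)
                        (within-capacity b a)
    cancelled : Feasible (bump f b a (- β))
    cancelled = bump-feasible b a (- β) feasible (0≤q-p (p⊓q≤q ε fba)) fba-β≤cap
    fab+ε-β≤cap : fab + (ε - β) ≤ cap a b
    fab+ε-β≤cap with ⊓-sel ε fba
    ... | inj₁ β≡ε   rewrite β≡ε = ≤-trans (≤-reflexive (trans (cong (fab +_) (+-inverseʳ ε)) (+-identityʳ fab)))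
                                           (within-capacity a b)
    ... | inj₂ β≡fba rewrite β≡fba = begin
      fab + (ε - fba)                           ≤⟨ +-monoʳ-≤ fab (+-monoˡ-≤ (- fba) ε≤res) ⟩
      fab + (residual f a b - fba)              ≡⟨ solve 3 (λ c u v → u :+ (((c :- u) :+ v) :- v) := c) refl (cap a b) fab fba ⟩
      cap a b                                   ∎
      where open ≤-Reasoning

  push-residual : ∀ {f} a b {ε} → Feasible f → 0ℚ ≤ ε → ∀ x y →
                  residual f x y ≤ residual (push f a b ε) x y + ε
  push-residual {f} a b {ε} feasible 0≤ε x y = begin
    residual f x y                                      ≤⟨ bump-residual f b a 0≤β -β≤β (≤-reflexive (⁻¹-involutive β)) x y ⟩
    residual (bump f b a (- β)) x y + β                 ≤⟨ +-monoˡ-≤ β (bump-residual (bump f b a (- β)) a b 0≤ε-β ≤-refl -ε+β≤ε-β x y) ⟩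
    residual (push f a b ε) x y + (ε - β) + β           ≡⟨ solve 3 (λ r e b → (r :+ (e :- b)) :+ b := r :+ e) refl (residual (push f a b ε) x y) ε β ⟩
    residual (push f a b ε) x y + ε                     ∎
    where
    open ≤-Reasoning
    β = cancellable f a b ε
    0≤β : 0ℚ ≤ β
    0≤β = ⊓-glb 0≤ε (Feasible.nonneg feasible _ _)
    -β≤β : - β ≤ β
    -β≤β = ≤-trans (neg-antimono-≤ 0≤β) 0≤β
    0≤ε-β : 0ℚ ≤ ε - β
    0≤ε-β = 0≤q-p (p⊓q≤p ε _)
    -ε+β≤ε-β : - (ε - β) ≤ ε - β
    -ε+β≤ε-β = ≤-trans (neg-antimono-≤ 0≤ε-β) 0≤ε-β

  bumpSink : Flow → Fin n → ℚ → Flow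
  bumpSink f c ε (just x) nothing = f (just x) nothing + 𝟙 (x == c) ε
  bumpSink f c ε a        b       = f a b

  netOutflow-bumpSink : ∀ f c ε x → netOutflow (bumpSink f c ε) x ≡ netOutflow f x + 𝟙 (x == c) ε
  netOutflow-bumpSink f c ε x =
    solve 4 (λ t k o i → ((t :+ k) :+ o) :- i := ((t :+ o) :- i) :+ k) refl
      (f (just x) nothing) (𝟙 (x == c) ε) (sumFin λ y → f (just x) (just y)) (inflow f x)

  bumpSink-feasible : ∀ {f c ε} → Feasible f → 0ℚ ≤ ε → C c → Feasible (bumpSink f c ε)
  bumpSink-feasible {f} {c} {ε} feasible 0≤ε c∈C = record
    { nonneg             = nonneg′
    ; within-capacity    = within-capacity
    ; sink-emits-nothing = sink-emits-nothing
    ; sink-fed-from-C    = λ u u∉C → trans (cong₂ (λ t b → t + 𝟙 b ε) (sink-fed-from-C u u∉C) (==-≢ {x = u} {y = c} λ { refl → u∉C c∈C }))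
                                           (+-identityʳ 0ℚ)
    }
    where
    open Feasible feasible
    nonneg′ : ∀ a b → 0ℚ ≤ bumpSink f c ε a b
    nonneg′ (just x) nothing  = +-nonneg (nonneg _ _) (𝟙-nonneg (x == c) 0≤ε)
    nonneg′ (just x) (just y) = nonneg _ _
    nonneg′ nothing  b        = nonneg _ _

  length : ∀ {R : Fin n → Fin n → Set} {x y} → Star R x y → ℕ
  length []      = 0
  length (_ ◅ π) = suc (length π)

  -- pushing ε along a walk on which every residual is at least θ; each push lowers any residual
  -- by at most ε, so a budget of (length · ε) ≤ θ keeps every later push feasible
  augment : ∀ {f} → Feasible f → ∀ {ε θ} → 0ℚ ≤ ε → ∀ {v x} (π : Star (λ a b → θ ≤ residual f a b) v x) →
            length π · ε ≤ θ →
            ∃ λ g → Feasible g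
                  × (∀ z → netOutflow g z ≡ netOutflow f z + (𝟙 (z == v) ε - 𝟙 (z == x) ε))
                  × (∀ a b → residual f a b ≤ residual g a b + length π · ε)
  augment {f} feasible {ε} 0≤ε {v} [] _ =
    f , feasible ,
    (λ z → sym (trans (cong (netOutflow f z +_) (+-inverseʳ (𝟙 (z == v) ε))) (+-identityʳ _))) ,
    (λ a b → ≤-reflexive (sym (+-identityʳ _)))
  augment {f} feasible {ε} {θ} 0≤ε {v} {x} (_◅_ {j = y} θ≤res π) budget
    with augment feasible 0≤ε π (≤-trans (≤-by-nonneg-difference ε (+-comm ε (length π · ε)) 0≤ε) budget)
  ... | g , feasible-g , net-g , drift-g =
    push g v y ε , push-feasible feasible-g 0≤ε ε≤res , net , drift
    where
    L = length π · ε
    ε≤res : ε ≤ residual g v y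
    ε≤res = +-cancelʳ-≤ L (≤-trans budget (≤-trans θ≤res (drift-g v y)))
    net : ∀ z → netOutflow (push g v y ε) z ≡ netOutflow f z + (𝟙 (z == v) ε - 𝟙 (z == x) ε)
    net z = trans (netOutflow-push g v y ε z) (trans (cong (_+ (𝟙 (z == v) ε - 𝟙 (z == y) ε)) (net-g z))
      (solve 4 (λ N V Y X → (N :+ (Y :- X)) :+ (V :- Y) := N :+ (V :- X)) refl
        (netOutflow f z) (𝟙 (z == v) ε) (𝟙 (z == y) ε) (𝟙 (z == x) ε)))
    drift : ∀ a b → residual f a b ≤ residual (push g v y ε) a b + (ε + L)
    drift a b = ≤-trans (drift-g a b) (≤-trans (+-monoˡ-≤ L (push-residual v y feasible-g 0≤ε a b))
      (≤-reflexive (+-assoc (residual (push g v y ε) a b) ε L)))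

  uniform-threshold : ∀ {r : Fin n → Fin n → ℚ} {x y} → Star (λ a b → 0ℚ < r a b) x y →
                      ∃ λ θ → 0ℚ < θ × Star (λ a b → θ ≤ r a b) x y
  uniform-threshold []        = 1ℚ , positive⁻¹ 1ℚ , []
  uniform-threshold {r} (_◅_ {i = a} {j = b} 0<r π) with uniform-threshold π
  ... | θ , 0<θ , π′ = r a b ⊓ θ , 0<min , p⊓q≤p (r a b) θ ◅ mapStar (≤-trans (p⊓q≤q (r a b) θ)) π′
    where
    0<min : 0ℚ < r a b ⊓ θ
    0<min with ⊓-sel (r a b) θ
    ... | inj₁ min≡r = subst (0ℚ <_) (sym min≡r) 0<r
    ... | inj₂ min≡θ = subst (0ℚ <_) (sym min≡θ) 0<θ

  augmenting-path⇒larger-flow : ∀ {f} → IsNetworkFlow f → ∀ {c} → C c →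
    Star (λ a b → 0ℚ < residual f a b) s c → ∃ λ g → IsNetworkFlow g × flowValue s f < flowValue s g
  augmenting-path⇒larger-flow {f} flow {c} c∈C π with uniform-threshold π
  ... | θ , 0<θ , π′ with small-multiple (length π′) 0<θ
  ... | ε , 0<ε , _ , budget with augment (flow-feasible flow) (<⇒≤ 0<ε) π′ budget
  ... | g , feasible-g , net-g , _ = h , balanced-flow feasible-h balanced , value-grows
    where
    h = bumpSink g c ε
    feasible-h = bumpSink-feasible feasible-g (<⇒≤ 0<ε) c∈C
    net-h : ∀ z → netOutflow h z ≡ netOutflow f z + 𝟙 (z == s) ε
    net-h z = trans (netOutflow-bumpSink g c ε z) (trans (cong (_+ 𝟙 (z == c) ε) (net-g z))
      (solve 3 (λ N S K → (N :+ (S :- K)) :+ K := N :+ S) refl (netOutflow f z) (𝟙 (z == s) ε) (𝟙 (z == c) ε)))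
    balanced : ∀ z → z ≢ s → netOutflow h z ≡ 0ℚ
    balanced z z≢s = trans (net-h z) (trans (cong₂ (λ N b → N + 𝟙 b ε) (flow-balanced flow z z≢s) (==-≢ z≢s))
                                             (+-identityʳ 0ℚ))
    value-grows : flowValue s f < flowValue s h
    value-grows = begin-strict
      netOutflow f s        ≡⟨ +-identityʳ _ ⟨
      netOutflow f s + 0ℚ   <⟨ +-monoʳ-< (netOutflow f s) 0<ε ⟩
      netOutflow f s + ε    ≡⟨ cong (λ b → netOutflow f s + 𝟙 b ε) (==-refl s) ⟨
      netOutflow f s + 𝟙 (s == s) ε ≡⟨ net-h s ⟨
      netOutflow h s        ∎
      where open ≤-Reasoning

  residualReachable : Flow → Subset n
  residualReachable f = Reachability.reachable (λ a b → 0ℚ <? residual f a b) s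

  max-flow⇒sinks-unreachable : ∀ {f} → IsMaxNetworkFlow f → ∀ {c} → C c → c ∉ residualReachable f
  max-flow⇒sinks-unreachable {f} (flow , maximal) c∈C c∈R = no-larger (augmenting-path⇒larger-flow flow c∈C path)
    where
    path : Star (λ a b → 0ℚ < residual f a b) s _
    path = Reachability.reachable-path {E = λ a b → 0ℚ < residual f a b} (λ a b → 0ℚ <? residual f a b) s c∈R
    no-larger : ¬ (∃ λ g → IsNetworkFlow g × flowValue s f < flowValue s g)
    no-larger (g , flow-g , f<g) = <-irrefl refl (<-≤-trans f<g (maximal g flow-g))

  sinkflow≡netInflow : ∀ {f} → IsNetworkFlow f → ∀ y → y ≢ s →
                       f (just y) nothing ≡ sumFin (λ x → netFlow f x y)
  sinkflow≡netInflow {f} (_ , _ , sink-emits-nothing , _ , conserved) y y≢s = begin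
    f (just y) nothing            ≡⟨ solve 2 (λ t o → t := (t :+ o) :- o) refl (f (just y) nothing) out ⟩
    outflow f y - out             ≡⟨ cong (_- out) (conserved y y≢s) ⟨
    inflow f y - out              ≡⟨ cong (λ t → t + into - out) (sink-emits-nothing (just y)) ⟩
    0ℚ + into - out               ≡⟨ cong (_- out) (+-identityˡ into) ⟩
    into - out                    ≡⟨ sumFin-- (λ x → f (just x) (just y)) (λ x → f (just y) (just x)) ⟨
    sumFin (λ x → netFlow f x y)  ∎
    where
    open ≡-Reasoning
    into = sumFin λ x → f (just x) (just y)
    out  = sumFin λ x → f (just y) (just x)

  sinkflow-across : ∀ {f} → IsNetworkFlow f → ∀ {A} → s ∈ A →
    sumFin (λ y → 𝟙 (not (lookup A y)) (f (just y) nothing)) ≡ crossing A (netFlow f)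
  sinkflow-across {f} flow {A} s∈A = begin
    sumFin (λ y → 𝟙 (not (lookup A y)) (f (just y) nothing))
      ≡⟨ sumFin-cong (λ y → 𝟙-∉-cong λ y∉A → sinkflow≡netInflow flow y λ { refl → y∉A s∈A }) ⟩
    sumFin (λ y → 𝟙 (not (lookup A y)) (sumFin λ x → netFlow f x y))
      ≡⟨ sumFin-cong (λ y → trans (cong (𝟙 (not (lookup A y))) (sumFin-split (lookup A) (λ x → netFlow f x y)))
                                  (𝟙-+ (not (lookup A y)) _ _)) ⟩
    sumFin (λ y → 𝟙 (not (lookup A y)) (inflowFrom A (netFlow f) y) + withinĀ y)
      ≡⟨ sumFin-+ (λ y → 𝟙 (not (lookup A y)) (inflowFrom A (netFlow f) y)) withinĀ ⟩
    crossing A (netFlow f) + sumFin withinĀ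
      ≡⟨ cong (crossing A (netFlow f) +_) (sumFin-antisymmetric≡0 (not ∘ lookup A) λ x y → f (just x) (just y)) ⟩
    crossing A (netFlow f) + 0ℚ
      ≡⟨ +-identityʳ _ ⟩
    crossing A (netFlow f) ∎
    where
    open ≡-Reasoning
    withinĀ : Fin n → ℚ
    withinĀ y = 𝟙 (not (lookup A y)) (sumFin λ x → 𝟙 (not (lookup A x)) (netFlow f x y))

  sinkflow≤crossing : ∀ {f} → IsNetworkFlow f → ∀ {A} → s ∈ A →
    sumFin (λ y → 𝟙 (not (lookup A y)) (f (just y) nothing)) ≤ crossing A cap
  sinkflow≤crossing {f} flow {A} s∈A = ≤-trans (≤-reflexive (sinkflow-across flow s∈A))
    (crossing-mono {A = A} {u = netFlow f} {v = cap} λ {y} _ →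
       inflowFrom-mono {A = A} {u = netFlow f} {v = cap} {y = y} λ {x} _ → netFlow≤cap (flow-feasible flow) x y)

  crossing≤sinkflow : ∀ {f} → IsNetworkFlow f → ∀ {A} → s ∈ A →
    (∀ {x y} → x ∈ A → y ∉ A → cap x y ≤ netFlow f x y) →
    crossing A cap ≤ sumFin (λ y → 𝟙 (not (lookup A y)) (f (just y) nothing))
  crossing≤sinkflow {f} flow {A} s∈A saturated-cut = ≤-trans
    (crossing-mono {A = A} {u = cap} {v = netFlow f} λ {y} y∉A →
       inflowFrom-mono {A = A} {u = cap} {v = netFlow f} {y = y} λ x∈A → saturated-cut x∈A y∉A)
    (≤-reflexive (sym (sinkflow-across flow s∈A)))

-- The network G_i

module CentroidNetwork {n : ℕ} (w : Weights n) (s : Fin n) (same : Fin n → Fin n → Bool) where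

  wIn wOut : Fin n → Fin n → ℚ
  wIn  x y = 𝟙 (same x y) (w x y)
  wOut x y = if same x y then 0ℚ else w x y

  w≡wIn+wOut : ∀ x y → w x y ≡ wIn x y + wOut x y
  w≡wIn+wOut x y with same x y
  ... | true  = sym (+-identityʳ _)
  ... | false = sym (+-identityˡ _)

  inflowFrom-capG : ∀ {B y} → s ∈ B →
    inflowFrom B (capG w s same) y ≡ inflowFrom B wIn y + sumFin (λ z → wOut z y)
  inflowFrom-capG {B} {y} s∈B = begin
    inflowFrom B (capG w s same) y
      ≡⟨ trans (sumFin-cong λ x → 𝟙-+ (lookup B x) (wIn x y) (𝟙 (x == s) K))
               (sumFin-+ (λ x → 𝟙 (lookup B x) (wIn x y)) λ x → 𝟙 (lookup B x) (𝟙 (x == s) K)) ⟩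
    inflowFrom B wIn y + sumFin (λ x → 𝟙 (lookup B x) (𝟙 (x == s) K))
      ≡⟨ cong (inflowFrom B wIn y +_) (trans (sumFin-cong λ x → 𝟙-comm (lookup B x) (x == s) K)
                                             (trans (sumFin-δ s λ z → 𝟙 (lookup B z) K) (𝟙-∈ s∈B K))) ⟩
    inflowFrom B wIn y + K ∎
    where
    open ≡-Reasoning
    K = sumFin λ z → wOut z y

  inflowFrom-w : ∀ B y → inflowFrom B w y ≡ inflowFrom B wIn y + inflowFrom B wOut y
  inflowFrom-w B y = trans
    (sumFin-cong λ x → trans (cong (𝟙 (lookup B x)) (w≡wIn+wOut x y)) (𝟙-+ (lookup B x) (wIn x y) (wOut x y)))
    (sumFin-+ (λ x → 𝟙 (lookup B x) (wIn x y)) λ x → 𝟙 (lookup B x) (wOut x y))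

  inflowFrom-w≤capG : NonNeg w → ∀ {B y} → s ∈ B → inflowFrom B w y ≤ inflowFrom B (capG w s same) y
  inflowFrom-w≤capG w≥0 {B} {y} s∈B = begin
    inflowFrom B w y                                ≡⟨ inflowFrom-w B y ⟩
    inflowFrom B wIn y + inflowFrom B wOut y        ≤⟨ +-monoʳ-≤ (inflowFrom B wIn y) (sumFin-mono λ z → 𝟙≤ (lookup B z) (wOut≥0 z)) ⟩
    inflowFrom B wIn y + sumFin (λ z → wOut z y)    ≡⟨ inflowFrom-capG s∈B ⟨
    inflowFrom B (capG w s same) y                  ∎
    where
    open ≤-Reasoning
    wOut≥0 : ∀ z → 0ℚ ≤ wOut z y
    wOut≥0 z with same z y
    ... | true  = ≤-refl
    ... | false = w≥0 z y

  inflowFrom-capG≤w : ∀ {B y} → s ∈ B → (∀ {z} → z ∉ B → same z y ≡ true) →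
                      inflowFrom B (capG w s same) y ≤ inflowFrom B w y
  inflowFrom-capG≤w {B} {y} s∈B outside-same = begin
    inflowFrom B (capG w s same) y                  ≡⟨ inflowFrom-capG s∈B ⟩
    inflowFrom B wIn y + sumFin (λ z → wOut z y)    ≤⟨ +-monoʳ-≤ (inflowFrom B wIn y) (sumFin-mono wOut≤) ⟩
    inflowFrom B wIn y + inflowFrom B wOut y        ≡⟨ inflowFrom-w B y ⟨
    inflowFrom B w y                                ∎
    where
    open ≤-Reasoning
    wOut≤ : ∀ z → wOut z y ≤ 𝟙 (lookup B z) (wOut z y)
    wOut≤ z with lookup B z in eq
    ... | true  = ≤-refl
    ... | false rewrite outside-same {z} (λ z∈B → contradiction (trans (sym ([]=⇒lookup z∈B)) eq) λ ()) = ≤-refl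

  capG-between-parts : ∀ {x y} → same x y ≡ false → x ≢ s → capG w s same x y ≡ 0ℚ
  capG-between-parts {x} {y} ¬same x≢s rewrite ¬same | ==-≢ x≢s = +-identityʳ 0ℚ

-- Minimum cuts from maximum flows of G_i

module CentroidCut
  {n : ℕ} (w : Weights n) (w≥0 : NonNeg w) (s : Fin n) (p : Fin n → Fin n)
  (ch : Subset n → Fin n) (centroid : ∀ i U → Part s p ch i U → IsCentroid s p U (ch U))
  (i : ℕ) (same : Fin n → Fin n → Bool) (same⇔ : ∀ x y → T (same x y) ⇔ SamePart s p ch i x y)
  (f : Node n → Node n → ℚ) (max-flow : IsMaxFlow w s p ch i same f)
  {U : Subset n} (U∈P : Part s p ch i U) where

  open Components s p
  open Network (capG w s same) s (InC s p ch i)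
  open CentroidNetwork w s same

  u : Fin n
  u = ch U

  u∈U : u ∈ U
  u∈U = proj₁ (centroid i U U∈P)

  s∉U : s ∉ U
  s∉U s∈U = part-excludes-root ch U∈P s∈U refl

  outside-∁U : ∀ {B x} → ∁ U ⊆ B → x ∉ B → x ∈ U
  outside-∁U {B} {x} ∁U⊆B x∉B = decidable-stable (x ∈? U) λ x∉U → x∉B (∁U⊆B (x∉p⇒x∈∁p x∉U))

  same-within-U : ∀ {x y} → x ∈ U → y ∈ U → same x y ≡ true
  same-within-U {x} {y} x∈U y∈U = Equivalence.to T-≡ (Equivalence.from (same⇔ x y) (U , U∈P , x∈U , y∈U))

  same-into-U : ∀ {x y} → y ∈ U → same x y ≡ true → x ∈ U
  same-into-U {x} {y} y∈U same-xy with Equivalence.to (same⇔ x y) (Equivalence.from T-≡ same-xy)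
  ... | U′ , U′∈P , x∈U′ , y∈U′ with refl ← part-unique ch U′∈P U∈P y∈U′ y∈U = x∈U′

  same-out-of-U : ∀ {x y} → x ∈ U → same x y ≡ true → y ∈ U
  same-out-of-U {x} {y} x∈U same-xy with Equivalence.to (same⇔ x y) (Equivalence.from T-≡ same-xy)
  ... | U′ , U′∈P , x∈U′ , y∈U′ with refl ← part-unique ch U′∈P U∈P x∈U′ x∈U = y∈U′

  only-centroid-feeds-sink : ∀ {y} → y ∈ U → InC s p ch i y → y ≡ u
  only-centroid-feeds-sink y∈U (U′ , U′∈P , refl)
    with refl ← part-unique ch U′∈P U∈P (proj₁ (centroid i U′ U′∈P)) y∈U = refl

  flow : IsNetworkFlow f
  flow = proj₁ max-flow

  sinkflow≤cut : ∀ B → ∁ U ⊆ B → u ∉ B → f (just u) nothing ≤ cutW w B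
  sinkflow≤cut B ∁U⊆B u∉B = begin
    f (just u) nothing                                          ≡⟨ 𝟙-∉ u∉B _ ⟨
    𝟙 (not (lookup B u)) (f (just u) nothing)                   ≤⟨ term≤sumFin (λ y → 𝟙-nonneg _ (Feasible.nonneg (flow-feasible flow) _ _)) u ⟩
    sumFin (λ y → 𝟙 (not (lookup B y)) (f (just y) nothing))    ≤⟨ sinkflow≤crossing flow s∈B ⟩
    crossing B (capG w s same)                                  ≤⟨ crossing-mono {A = B} {u = capG w s same} {v = w} capG≤w ⟩
    crossing B w                                                ≡⟨ cutW≡crossing w B ⟨
    cutW w B                                                    ∎
    where
    open ≤-Reasoning
    s∈B = ∁U⊆B (x∉p⇒x∈∁p s∉U)
    capG≤w : ∀ {y} → y ∉ B → inflowFrom B (capG w s same) y ≤ inflowFrom B w y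
    capG≤w y∉B = inflowFrom-capG≤w s∈B λ z∉B → same-within-U (outside-∁U ∁U⊆B z∉B) (outside-∁U ∁U⊆B y∉B)

  residualCut : Subset n
  residualCut = residualReachable f ∪ ∁ U

  ∁U⊆residualCut : ∁ U ⊆ residualCut
  ∁U⊆residualCut x∈∁U = x∈p∪q⁺ (inj₂ x∈∁U)

  s∈residualCut : s ∈ residualCut
  s∈residualCut = x∈p∪q⁺ (inj₁ (Reachability.source-reachable _ s))

  u∉residualCut : u ∉ residualCut
  u∉residualCut u∈A with x∈p∪q⁻ (residualReachable f) (∁ U) u∈A
  ... | inj₁ u∈R  = max-flow⇒sinks-unreachable max-flow (U , U∈P , refl) u∈R
  ... | inj₂ u∈∁U = x∈∁p⇒x∉p u∈∁U u∈U

  residualCut-saturated : ∀ {x y} → x ∈ residualCut → y ∉ residualCut → capG w s same x y ≤ netFlow f x y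
  residualCut-saturated {x} {y} x∈A y∉A with x ∈? residualReachable f
  ... | yes x∈R = saturated {f = f} (≮⇒≥ λ 0<res → y∉A (x∈p∪q⁺ (inj₁ (Reachability.reachable-step _ s x∈R 0<res))))
  ... | no  x∉R = subst (_≤ netFlow f x y) (sym capxy≡0) (no-backflow {f = f} (flow-feasible flow) capyx≡0)
    where
    y∈U : y ∈ U
    y∈U = outside-∁U ∁U⊆residualCut y∉A
    x∉U : x ∉ U
    x∉U with x∈p∪q⁻ (residualReachable f) (∁ U) x∈A
    ... | inj₁ x∈R  = contradiction x∈R x∉R
    ... | inj₂ x∈∁U = x∈∁p⇒x∉p x∈∁U
    capxy≡0 : capG w s same x y ≡ 0ℚ
    capxy≡0 = capG-between-parts (¬-not λ same-xy → x∉U (same-into-U y∈U same-xy))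
                                 (λ { refl → x∉R (Reachability.source-reachable _ s) })
    capyx≡0 : capG w s same y x ≡ 0ℚ
    capyx≡0 = capG-between-parts (¬-not λ same-yx → x∉U (same-out-of-U y∈U same-yx)) λ { refl → s∉U y∈U }

  cut≤sinkflow : cutW w residualCut ≤ f (just u) nothing
  cut≤sinkflow = begin
    cutW w residualCut                                                ≡⟨ cutW≡crossing w residualCut ⟩
    crossing residualCut w
      ≤⟨ crossing-mono {A = residualCut} {u = w} {v = capG w s same} (λ _ → inflowFrom-w≤capG w≥0 s∈residualCut) ⟩
    crossing residualCut (capG w s same)                              ≤⟨ crossing≤sinkflow flow s∈residualCut residualCut-saturated ⟩
    sumFin (λ y → 𝟙 (not (lookup residualCut y)) (f (just y) nothing)) ≡⟨ sumFin-single u others-silent ⟩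
    𝟙 (not (lookup residualCut u)) (f (just u) nothing)               ≡⟨ 𝟙-∉ u∉residualCut _ ⟩
    f (just u) nothing                                                ∎
    where
    open ≤-Reasoning
    others-silent : ∀ y → y ≢ u → 𝟙 (not (lookup residualCut y)) (f (just y) nothing) ≡ 0ℚ
    others-silent y y≢u = trans (𝟙-∉-cong λ y∉A → Feasible.sink-fed-from-C (flow-feasible flow) y
                                  λ y∈C → y≢u (only-centroid-feeds-sink (outside-∁U ∁U⊆residualCut y∉A) y∈C))
                                (𝟙-0 (not (lookup residualCut y)))

lemma2p9 : (n : ℕ) (w : Weights n) → NonNeg w → (s : Fin n) (p : Fin n → Fin n)
    → IsArborescence w s p
    → (ch : Subset n → Fin n)
    → (∀ i U → Part s p ch i U → IsCentroid s p U (ch U))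
    → (i : ℕ) (same : Fin n → Fin n → Bool)
    → (∀ x y → T (same x y) ⇔ SamePart s p ch i x y)
    → (f : Node n → Node n → ℚ) → IsMaxFlow w s p ch i same f
    → ∀ U → Part s p ch i U → IsMinCutValue w U (ch U) (f (just (ch U)) nothing)
lemma2p9 n w w≥0 s p _ ch centroid i same same⇔ f max-flow U U∈P =
  ( residualCut , ∁U⊆residualCut , u∉residualCut
  , ≤-antisym cut≤sinkflow (sinkflow≤cut residualCut ∁U⊆residualCut u∉residualCut) )
  , sinkflow≤cut
  where open CentroidCut w w≥0 s p ch centroid i same same⇔ f max-flow U∈P
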